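{- Let $\mathbb{A}$ be an $\mathcal{L}$-algebra, $F$ a filter of $\mathbb{A}$, $I$ an ideal of $\mathbb{A}$, $1\le i\le n_g$ for $g\in\mathcal G$, and $1\le i\le n_f$ for $f\in\mathcal F$, with $\overline I^i$ admissible for $g$ and $\overline F^i$ admissible for $f$ (with the $i$-th entry removed). Then: (1) if $\epsilon_g(i)=1$, $g^{(i)}(F,\overline I^i)$ is a filter; (2) if $\epsilon_g(i)=\partial$, $g^{(i)}(F,\overline I^i)$ is an ideal; (3) if $\epsilon_f(i)=1$, $f^{(i)}(I,\overline F^i)$ is an ideal; (4) if $\epsilon_f(i)=\partial$, $f^{(i)}(I,\overline F^i)$ is a filter.
   Context: $\mathcal{L}(\mathcal F,\mathcal G)$ is an LE-signature, $f\in\mathcal F$ with arity $n_f$ and order type $\epsilon_f\in\{1,\partial\}^{n_f}$, $g\in\mathcal G$ with arity $n_g$ and order type $\epsilon_g$. An $\mathcal{L}$-algebra is a bounded lattice with operations $f$ preserving finite joins (incl. $\bot$) in coordinates with $\epsilon_f(k)=1$ and sending finite meets (incl. $\top$) to joins in coordinates with $\epsilon_f(k)=\partial$, and $g$ preserving finite meets in coordinates with $\epsilon_g(k)=1$ and sending finite joins to meets in coordinates with $\epsilon_g(k)=\partial$. Admissible tuples: for $f$, $\overline F$ with $F_k$ a filter if $\epsilon_f(k)=1$ and an ideal if $\epsilon_f(k)=\partial$; for $g$, $\overline I$ with $I_k$ an ideal if $\epsilon_g(k)=1$ and a filter if $\epsilon_g(k)=\partial$. $\overline F^i$, $\overline I^i$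 denote such tuples with the $i$-th entry removed. $f^{(i)}(I,\overline F^i)=\{b\in\mathbb{A}\mid f(\overline a^i_b)\in I$ for some $\overline a^i$ with $a_k\in F_k$ $(k\neq i)\}$ and $g^{(i)}(F,\overline I^i)=\{b\in\mathbb{A}\mid g(\overline a^i_b)\in F$ for some $\overline a^i$ with $a_k\in I_k$ $(k\ne i)\}$, where $\overline a^i_b$ is $\overline a^i$ with $b$ inserted at position $i$. -}

module Defs where

open import Level using (Level; _⊔_) renaming (suc to lsuc)
open import Data.Nat using (ℕ)
open import Data.Fin using (Fin; _≟_)
open import Data.Product using (Σ; _×_; ∃)
open import Relation.Nullary using (¬_; yes; no)
open import Relation.Binary.PropositionalEquality using (_≡_)
open import Relation.Binary.Lattice.Bundles using (BoundedLattice)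
open import Relation.Unary using (Pred; _∈_)

-- Order types: 1 (pos) and ∂ (neg)
data Polarity : Set where
  pos neg : Polarity

record LESig : Set₁ where
  field
    FOp   : Set
    GOp   : Set
    arᶠ   : FOp → ℕ
    arᵍ   : GOp → ℕ
    εᶠ    : (f : FOp) → Fin (arᶠ f) → Polarity
    εᵍ    : (g : GOp) → Fin (arᵍ g) → Polarity

_[_≔_] : ∀ {a} {A : Set a} {n : ℕ} → (Fin n → A) → Fin n → A → Fin n → A
(v [ k ≔ b ]) j with j ≟ k
... | yes _ = b
... | no  _ = v j

record LEAlgebra (L : LESig) (c ℓ₁ ℓ₂ : Level) : Set (lsuc (c ⊔ ℓ₁ ⊔ ℓ₂)) where
  open LESig L
  field
    boundedLattice : BoundedLattice c ℓ₁ ℓ₂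
  open BoundedLattice boundedLattice public hiding (lattice)
  field
    fop : (f : FOp) → (Fin (arᶠ f) → Carrier) → Carrier
    gop : (g : GOp) → (Fin (arᵍ g) → Carrier) → Carrier
    fop-cong : ∀ f {a b : Fin (arᶠ f) → Carrier} → (∀ k → a k ≈ b k) → fop f a ≈ fop f b
    gop-cong : ∀ g {a b : Fin (arᵍ g) → Carrier} → (∀ k → a k ≈ b k) → gop g a ≈ gop g b
    f-pos-∨ : ∀ f k → εᶠ f k ≡ pos → ∀ a x y →
              fop f (a [ k ≔ x ∨ y ]) ≈ (fop f (a [ k ≔ x ]) ∨ fop f (a [ k ≔ y ]))
    f-pos-⊥ : ∀ f k → εᶠ f k ≡ pos → ∀ a → fop f (a [ k ≔ ⊥ ]) ≈ ⊥
    f-neg-∧ : ∀ f k → εᶠ f k ≡ neg → ∀ a x y →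
              fop f (a [ k ≔ x ∧ y ]) ≈ (fop f (a [ k ≔ x ]) ∨ fop f (a [ k ≔ y ]))
    f-neg-⊤ : ∀ f k → εᶠ f k ≡ neg → ∀ a → fop f (a [ k ≔ ⊤ ]) ≈ ⊥
    g-pos-∧ : ∀ g k → εᵍ g k ≡ pos → ∀ a x y →
              gop g (a [ k ≔ x ∧ y ]) ≈ (gop g (a [ k ≔ x ]) ∧ gop g (a [ k ≔ y ]))
    g-pos-⊤ : ∀ g k → εᵍ g k ≡ pos → ∀ a → gop g (a [ k ≔ ⊤ ]) ≈ ⊤
    g-neg-∨ : ∀ g k → εᵍ g k ≡ neg → ∀ a x y →
              gop g (a [ k ≔ x ∨ y ]) ≈ (gop g (a [ k ≔ x ]) ∧ gop g (a [ k ≔ y ]))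
    g-neg-⊥ : ∀ g k → εᵍ g k ≡ neg → ∀ a → gop g (a [ k ≔ ⊥ ]) ≈ ⊤

module _ {c ℓ₁ ℓ₂ : Level} (B : BoundedLattice c ℓ₁ ℓ₂) where
  open BoundedLattice B

  IsFilter : ∀ {ℓ} → Pred Carrier ℓ → Set (c ⊔ ℓ₂ ⊔ ℓ)
  IsFilter P = (⊤ ∈ P)
             × (∀ {x y} → x ≤ y → x ∈ P → y ∈ P)
             × (∀ {x y} → x ∈ P → y ∈ P → (x ∧ y) ∈ P)

  IsIdeal : ∀ {ℓ} → Pred Carrier ℓ → Set (c ⊔ ℓ₂ ⊔ ℓ)
  IsIdeal P = (⊥ ∈ P)
            × (∀ {x y} → x ≤ y → y ∈ P → x ∈ P)
            × (∀ {x y} → x ∈ P → y ∈ P → (x ∨ y) ∈ P)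

module _ {L : LESig} {c ℓ₁ ℓ₂ : Level} (A : LEAlgebra L c ℓ₁ ℓ₂) where
  open LESig L
  open LEAlgebra A

  AdmissibleFᶦ : ∀ {ℓ} (f : FOp) (i : Fin (arᶠ f)) → (Fin (arᶠ f) → Pred Carrier ℓ) → Set (c ⊔ ℓ₂ ⊔ ℓ)
  AdmissibleFᶦ f i Fs = ∀ k → ¬ (k ≡ i) →
    (εᶠ f k ≡ pos → IsFilter boundedLattice (Fs k)) × (εᶠ f k ≡ neg → IsIdeal boundedLattice (Fs k))

  AdmissibleGᶦ : ∀ {ℓ} (g : GOp) (i : Fin (arᵍ g)) → (Fin (arᵍ g) → Pred Carrier ℓ) → Set (c ⊔ ℓ₂ ⊔ ℓ)
  AdmissibleGᶦ g i Is = ∀ k → ¬ (k ≡ i) →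
    (εᵍ g k ≡ pos → IsIdeal boundedLattice (Is k)) × (εᵍ g k ≡ neg → IsFilter boundedLattice (Is k))

  fⁱ : ∀ {ℓ} (f : FOp) (i : Fin (arᶠ f)) → Pred Carrier ℓ → (Fin (arᶠ f) → Pred Carrier ℓ) → Pred Carrier (c ⊔ ℓ)
  fⁱ f i I Fs b = Σ (Fin (arᶠ f) → Carrier) λ a →
    (∀ k → ¬ (k ≡ i) → a k ∈ Fs k) × (fop f (a [ i ≔ b ]) ∈ I)

  gⁱ : ∀ {ℓ} (g : GOp) (i : Fin (arᵍ g)) → Pred Carrier ℓ → (Fin (arᵍ g) → Pred Carrier ℓ) → Pred Carrier (c ⊔ ℓ)
  gⁱ g i F Is b = Σ (Fin (arᵍ g) → Carrier) λ a →
    (∀ k → ¬ (k ≡ i) → a k ∈ Is k) × (gop g (a [ i ≔ b ]) ∈ F)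

-- In every coordinate k, g is a meet-preserving map from A ordered by ε(k)
-- (≤ for 1, ≥ for ∂) to (A, ≤), and f is one from A ordered by the reverse of
-- ε(k) to (A, ≥).  For any such operation, the set of b for which op(ā^i_b) lies
-- in a filter of the codomain order for some admissible ā^i is a filter for the
-- order of coordinate i: the top of that order is sent to the top, monotonicity
-- gives upward closure, and since admissible sets are directed for their orders,
-- witnesses ā, b̄ for x and y have a common upper bound c̄, which by monotonicity
-- witnesses x ∧ y.  A filter for ≥ is an ideal, which yields the four cases.
module Submission where

open import Defs
open import Level using (Level; _⊔_)
open import Data.Nat using (ℕ)
open import Data.Fin using (Fin; _≟_)
open import Data.List using (List; []; _∷_; allFin)
open import Data.List.Membership.Propositional using () renaming (_∈_ to _∈ₗ_)
open import Data.List.Membership.Propositional.Properties using (∈-allFin)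
open import Data.List.Relation.Unary.Any using (here; there)
open import Data.Product using (Σ; ∃; _×_; _,_; proj₁; proj₂)
open import Data.Sum using (_⊎_; inj₁; inj₂)
open import Relation.Nullary using (¬_; yes; no)
open import Relation.Nullary.Negation using (contradiction)
open import Relation.Binary.PropositionalEquality using (_≡_; refl; sym)
open import Relation.Binary.Lattice.Bundles using (BoundedLattice)
import Relation.Binary.Lattice.Properties.MeetSemilattice as MeetSemilatticeProperties
import Relation.Binary.Lattice.Properties.JoinSemilattice as JoinSemilatticeProperties
open import Relation.Unary using (Pred; _∈_)

module _ {a} {A : Set a} {n : ℕ} where

  [≔]-self : (v : Fin n → A) (k j : Fin n) → (v [ k ≔ v k ]) j ≡ v j
  [≔]-self v k j with j ≟ k
  ... | yes refl = refl
  ... | no _     = refl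

  [≔]-pointwise : ∀ {r} {R : Fin n → A → A → Set r} {u v : Fin n → A} (i : Fin n) {x} →
                  (∀ {j} → R j x x) → (∀ k → ¬ k ≡ i → R k (u k) (v k)) →
                  ∀ j → R j ((u [ i ≔ x ]) j) ((v [ i ≔ x ]) j)
  [≔]-pointwise i R-refl R-outside j with j ≟ i
  ... | yes _  = R-refl
  ... | no j≢i = R-outside j j≢i

  tupleOutside : ∀ {q} {Q : Fin n → A → Set q} (i : Fin n) → A →
                 (∀ k → ¬ k ≡ i → ∃ (Q k)) → ∃ λ u → ∀ k → ¬ k ≡ i → Q k (u k)
  tupleOutside {Q = Q} i default exists = u , Q-u
    where
    u : Fin n → A
    u k with k ≟ i
    ... | yes _  = default
    ... | no k≢i = proj₁ (exists k k≢i)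

    Q-u : ∀ k → ¬ k ≡ i → Q k (u k)
    Q-u k k≢i with k ≟ i
    ... | yes k≡i = contradiction k≡i k≢i
    ... | no k≢i′ = proj₂ (exists k k≢i′)

dual : Polarity → Polarity
dual pos = neg
dual neg = pos

module Polarised {c ℓ₁ ℓ₂} (B : BoundedLattice c ℓ₁ ℓ₂) where
  open BoundedLattice B hiding (refl)
  open MeetSemilatticeProperties meetSemilattice using (∧-monotonic; y≤x⇒x∧y≈y)
  open JoinSemilatticeProperties joinSemilattice using (∨-monotonic; x≤y⇒x∨y≈y)

  infix 4 _≤⟨_⟩_

  _≤⟨_⟩_ : Carrier → Polarity → Carrier → Set ℓ₂
  x ≤⟨ pos ⟩ y = x ≤ y
  x ≤⟨ neg ⟩ y = y ≤ x

  _∧⟨_⟩_ : Carrier → Polarity → Carrier → Carrier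
  x ∧⟨ pos ⟩ y = x ∧ y
  x ∧⟨ neg ⟩ y = x ∨ y

  ⊤⟨_⟩ : Polarity → Carrier
  ⊤⟨ pos ⟩ = ⊤
  ⊤⟨ neg ⟩ = ⊥

  ≈⇒≤⟨_⟩ : ∀ p {x y} → x ≈ y → x ≤⟨ p ⟩ y
  ≈⇒≤⟨ pos ⟩ x≈y = reflexive x≈y
  ≈⇒≤⟨ neg ⟩ x≈y = reflexive (Eq.sym x≈y)

  ≤⟨_⟩-refl : ∀ p {x} → x ≤⟨ p ⟩ x
  ≤⟨ p ⟩-refl = ≈⇒≤⟨ p ⟩ Eq.refl

  ≤⟨_⟩-trans : ∀ p {x y z} → x ≤⟨ p ⟩ y → y ≤⟨ p ⟩ z → x ≤⟨ p ⟩ z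
  ≤⟨ pos ⟩-trans x≤y y≤z = trans x≤y y≤z
  ≤⟨ neg ⟩-trans y≤x z≤y = trans z≤y y≤x

  x∧⟨_⟩y≤x : ∀ p x y → x ∧⟨ p ⟩ y ≤⟨ p ⟩ x
  x∧⟨ pos ⟩y≤x = x∧y≤x
  x∧⟨ neg ⟩y≤x = x≤x∨y

  ∧⟨_⟩-monotonic : ∀ p {x x′ y y′} → x ≤⟨ p ⟩ x′ → y ≤⟨ p ⟩ y′ → x ∧⟨ p ⟩ y ≤⟨ p ⟩ x′ ∧⟨ p ⟩ y′
  ∧⟨ pos ⟩-monotonic = ∧-monotonic
  ∧⟨ neg ⟩-monotonic = ∨-monotonic

  ≤⟨_⟩⇒∧⟨⟩≈ : ∀ p {x y} → x ≤⟨ p ⟩ y → y ∧⟨ p ⟩ x ≈ x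
  ≤⟨ pos ⟩⇒∧⟨⟩≈ = y≤x⇒x∧y≈y
  ≤⟨ neg ⟩⇒∧⟨⟩≈ = x≤y⇒x∨y≈y

  module _ {ℓ : Level} where

    IsFilter⟨_⟩ : Polarity → Pred Carrier ℓ → Set (c ⊔ ℓ₂ ⊔ ℓ)
    IsFilter⟨ p ⟩ P = (⊤⟨ p ⟩ ∈ P)
                    × (∀ {x y} → x ≤⟨ p ⟩ y → x ∈ P → y ∈ P)
                    × (∀ {x y} → x ∈ P → y ∈ P → x ∧⟨ p ⟩ y ∈ P)

    IsDirected⟨_⟩ : Polarity → Pred Carrier ℓ → Set (c ⊔ ℓ₂ ⊔ ℓ)
    IsDirected⟨ p ⟩ P = (∃ λ x → x ∈ P)
                      × (∀ {x y} → x ∈ P → y ∈ P → ∃ λ z → z ∈ P × x ≤⟨ p ⟩ z × y ≤⟨ p ⟩ z)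

    module _ {P : Pred Carrier ℓ} where

      isIdeal⇒isFilter⟨neg⟩ : IsIdeal B P → IsFilter⟨ neg ⟩ P
      isIdeal⇒isFilter⟨neg⟩ (⊥∈P , down , ∨-closed) = ⊥∈P , down , ∨-closed

      isFilter⟨neg⟩⇒isIdeal : IsFilter⟨ neg ⟩ P → IsIdeal B P
      isFilter⟨neg⟩⇒isIdeal (⊥∈P , down , ∨-closed) = ⊥∈P , down , ∨-closed

      isFilter⟨_⟩-cases : ∀ p → IsFilter⟨ p ⟩ P → (p ≡ pos → IsFilter B P) × (p ≡ neg → IsIdeal B P)
      isFilter⟨ pos ⟩-cases filter = (λ _ → filter) , (λ ())
      isFilter⟨ neg ⟩-cases filter = (λ ()) , (λ _ → isFilter⟨neg⟩⇒isIdeal filter)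

      isFilter⟨dual_⟩-cases : ∀ p → IsFilter⟨ dual p ⟩ P → (p ≡ pos → IsIdeal B P) × (p ≡ neg → IsFilter B P)
      isFilter⟨dual pos ⟩-cases filter = (λ _ → isFilter⟨neg⟩⇒isIdeal filter) , (λ ())
      isFilter⟨dual neg ⟩-cases filter = (λ ()) , (λ _ → filter)

      isIdeal⇒isDirected⟨pos⟩ : IsIdeal B P → IsDirected⟨ pos ⟩ P
      isIdeal⇒isDirected⟨pos⟩ (⊥∈P , _ , ∨-closed) =
        (⊥ , ⊥∈P) , λ x∈P y∈P → _ , ∨-closed x∈P y∈P , x≤x∨y _ _ , y≤x∨y _ _

      isFilter⇒isDirected⟨neg⟩ : IsFilter B P → IsDirected⟨ neg ⟩ P
      isFilter⇒isDirected⟨neg⟩ (⊤∈P , _ , ∧-closed) =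
        (⊤ , ⊤∈P) , λ x∈P y∈P → _ , ∧-closed x∈P y∈P , x∧y≤x _ _ , x∧y≤y _ _

module _ {c ℓ₁ ℓ₂} (B : BoundedLattice c ℓ₁ ℓ₂) where
  open BoundedLattice B hiding (refl)
  open Polarised B

  [≔]-cong : ∀ {n} (v : Fin n → Carrier) k {x y} → x ≈ y → ∀ j → (v [ k ≔ x ]) j ≈ (v [ k ≔ y ]) j
  [≔]-cong v k x≈y j with j ≟ k
  ... | yes _ = x≈y
  ... | no _  = Eq.refl

  record IsDualOperator {n} (o : Polarity) (ε : Fin n → Polarity)
                        (op : (Fin n → Carrier) → Carrier) : Set (c ⊔ ℓ₁) where
    field
      cong   : ∀ {u v} → (∀ k → u k ≈ v k) → op u ≈ op v
      ∧-homo : ∀ k u x y → op (u [ k ≔ x ∧⟨ ε k ⟩ y ]) ≈ op (u [ k ≔ x ]) ∧⟨ o ⟩ op (u [ k ≔ y ])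
      ⊤-homo : ∀ k u → op (u [ k ≔ ⊤⟨ ε k ⟩ ]) ≈ ⊤⟨ o ⟩

  preimageAt : ∀ {n ℓ ℓ′} → ((Fin n → Carrier) → Carrier) → Fin n →
               Pred Carrier ℓ → (Fin n → Pred Carrier ℓ′) → Pred Carrier (c ⊔ ℓ ⊔ ℓ′)
  preimageAt {n} op i F Is b = Σ (Fin n → Carrier) λ u →
    (∀ k → ¬ (k ≡ i) → u k ∈ Is k) × (op (u [ i ≔ b ]) ∈ F)

  module DualOperatorProperties {n o ε op} (isDualOperator : IsDualOperator {n} o ε op) where
    open IsDualOperator isDualOperator

    monotoneAt : ∀ u k {x y} → x ≤⟨ ε k ⟩ y → op (u [ k ≔ x ]) ≤⟨ o ⟩ op (u [ k ≔ y ])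
    monotoneAt u k {x} {y} x≤y = ≤⟨ o ⟩-trans (≈⇒≤⟨ o ⟩ op[x]≈op[y]∧op[x]) (x∧⟨ o ⟩y≤x _ _)
      where
      op[x]≈op[y]∧op[x] : op (u [ k ≔ x ]) ≈ op (u [ k ≔ y ]) ∧⟨ o ⟩ op (u [ k ≔ x ])
      op[x]≈op[y]∧op[x] =
        Eq.trans (cong ([≔]-cong u k (Eq.sym (≤⟨ ε k ⟩⇒∧⟨⟩≈ x≤y)))) (∧-homo k u y x)

    -- u and v differ only at the coordinates in ks, which are raised one at a time.
    monotone-on : ∀ (ks : List (Fin n)) {u v} → (∀ j → u j ≤⟨ ε j ⟩ v j) →
                  (∀ j → u j ≈ v j ⊎ j ∈ₗ ks) → op u ≤⟨ o ⟩ op v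
    monotone-on [] {u} {v} u≤v u≈v = ≈⇒≤⟨ o ⟩ (cong λ j → agree (u≈v j))
      where
      agree : ∀ {j} → u j ≈ v j ⊎ j ∈ₗ [] → u j ≈ v j
      agree (inj₁ uj≈vj) = uj≈vj
    monotone-on (k ∷ ks) {u} {v} u≤v u≈v =
      ≤⟨ o ⟩-trans (≤⟨ o ⟩-trans (≈⇒≤⟨ o ⟩ (cong λ j → Eq.reflexive (sym ([≔]-self u k j))))
                                 (monotoneAt u k (u≤v k)))
                   (monotone-on ks u′≤v u′≈v)
      where
      u′ : Fin n → Carrier
      u′ = u [ k ≔ v k ]

      u′≤v : ∀ j → u′ j ≤⟨ ε j ⟩ v j
      u′≤v j with j ≟ k
      ... | yes refl = ≤⟨ ε j ⟩-refl
      ... | no _     = u≤v j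

      u′≈v : ∀ j → u′ j ≈ v j ⊎ j ∈ₗ ks
      u′≈v j with j ≟ k | u≈v j
      ... | yes refl | _               = inj₁ Eq.refl
      ... | no _     | inj₁ uj≈vj      = inj₁ uj≈vj
      ... | no j≢k   | inj₂ (here j≡k) = contradiction j≡k j≢k
      ... | no _     | inj₂ (there j∈ks) = inj₂ j∈ks

    monotone : ∀ {u v} → (∀ j → u j ≤⟨ ε j ⟩ v j) → op u ≤⟨ o ⟩ op v
    monotone u≤v = monotone-on (allFin n) u≤v (λ j → inj₂ (∈-allFin j))

  preimageAt-isFilter : ∀ {n ℓ ℓ′ o ε op} {F : Pred Carrier ℓ} {Is : Fin n → Pred Carrier ℓ′} →
                        IsDualOperator o ε op → IsFilter⟨ o ⟩ F → ∀ i →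
                        (∀ k → ¬ k ≡ i → IsDirected⟨ ε k ⟩ (Is k)) →
                        IsFilter⟨ ε i ⟩ (preimageAt op i F Is)
  preimageAt-isFilter {o = o} {ε} {op} {F} {Is} isDualOperator (⊤∈F , F-up , F-∧) i directed =
    ⊤∈preimage , up , meet
    where
    open IsDualOperator isDualOperator
    open DualOperatorProperties isDualOperator

    ⊤∈preimage : ⊤⟨ ε i ⟩ ∈ preimageAt op i F Is
    ⊤∈preimage with tupleOutside i ⊤ (λ k k≢i → proj₁ (directed k k≢i))
    ... | u , u∈Is = u , u∈Is , F-up (≈⇒≤⟨ o ⟩ (Eq.sym (⊤-homo i u))) ⊤∈F

    up : ∀ {x y} → x ≤⟨ ε i ⟩ y → x ∈ preimageAt op i F Is → y ∈ preimageAt op i F Is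
    up x≤y (u , u∈Is , op[x]∈F) = u , u∈Is , F-up (monotoneAt u i x≤y) op[x]∈F

    meet : ∀ {x y} → x ∈ preimageAt op i F Is → y ∈ preimageAt op i F Is →
           x ∧⟨ ε i ⟩ y ∈ preimageAt op i F Is
    meet {x} {y} (u , u∈Is , op[u,x]∈F) (v , v∈Is , op[v,y]∈F)
      with tupleOutside i ⊤ (λ k k≢i → proj₂ (directed k k≢i) (u∈Is k k≢i) (v∈Is k k≢i))
    ... | w , bound = w , (λ k k≢i → proj₁ (bound k k≢i)) ,
      F-up (≤⟨ o ⟩-trans (∧⟨ o ⟩-monotonic (monotone u≤w) (monotone v≤w))
                         (≈⇒≤⟨ o ⟩ (Eq.sym (∧-homo i w x y))))
           (F-∧ op[u,x]∈F op[v,y]∈F)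
      where
      u≤w : ∀ j → (u [ i ≔ x ]) j ≤⟨ ε j ⟩ (w [ i ≔ x ]) j
      u≤w = [≔]-pointwise {R = λ j → _≤⟨ ε j ⟩_} i ≤⟨ ε _ ⟩-refl
              (λ k k≢i → proj₁ (proj₂ (bound k k≢i)))

      v≤w : ∀ j → (v [ i ≔ y ]) j ≤⟨ ε j ⟩ (w [ i ≔ y ]) j
      v≤w = [≔]-pointwise {R = λ j → _≤⟨ ε j ⟩_} i ≤⟨ ε _ ⟩-refl
              (λ k k≢i → proj₂ (proj₂ (bound k k≢i)))

module _ {L : LESig} {c ℓ₁ ℓ₂} (A : LEAlgebra L c ℓ₁ ℓ₂) where
  open LESig L
  open LEAlgebra A
  open Polarised boundedLattice

  gop-isDualOperator : ∀ g → IsDualOperator boundedLattice pos (εᵍ g) (gop g)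
  gop-isDualOperator g = record { cong = gop-cong g ; ∧-homo = ∧-homo ; ⊤-homo = ⊤-homo }
    where
    ∧-homo : ∀ k u x y →
             gop g (u [ k ≔ x ∧⟨ εᵍ g k ⟩ y ]) ≈ gop g (u [ k ≔ x ]) ∧ gop g (u [ k ≔ y ])
    ∧-homo k with εᵍ g k in eq
    ... | pos = g-pos-∧ g k eq
    ... | neg = g-neg-∨ g k eq

    ⊤-homo : ∀ k u → gop g (u [ k ≔ ⊤⟨ εᵍ g k ⟩ ]) ≈ ⊤
    ⊤-homo k with εᵍ g k in eq
    ... | pos = g-pos-⊤ g k eq
    ... | neg = g-neg-⊥ g k eq

  fop-isDualOperator : ∀ f → IsDualOperator boundedLattice neg (λ k → dual (εᶠ f k)) (fop f)
  fop-isDualOperator f = record { cong = fop-cong f ; ∧-homo = ∧-homo ; ⊤-homo = ⊤-homo }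
    where
    ∧-homo : ∀ k u x y →
             fop f (u [ k ≔ x ∧⟨ dual (εᶠ f k) ⟩ y ]) ≈ fop f (u [ k ≔ x ]) ∨ fop f (u [ k ≔ y ])
    ∧-homo k with εᶠ f k in eq
    ... | pos = f-pos-∨ f k eq
    ... | neg = f-neg-∧ f k eq

    ⊤-homo : ∀ k u → fop f (u [ k ≔ ⊤⟨ dual (εᶠ f k) ⟩ ]) ≈ ⊥
    ⊤-homo k with εᶠ f k in eq
    ... | pos = f-pos-⊥ f k eq
    ... | neg = f-neg-⊤ f k eq

  module _ {ℓ : Level} where

    admissibleGᶦ⇒isDirected : ∀ {g i} {Is : Fin (arᵍ g) → Pred Carrier ℓ} → AdmissibleGᶦ A g i Is →
                              ∀ k → ¬ k ≡ i → IsDirected⟨ εᵍ g k ⟩ (Is k)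
    admissibleGᶦ⇒isDirected {g} adm k k≢i with εᵍ g k in eq
    ... | pos = isIdeal⇒isDirected⟨pos⟩ (proj₁ (adm k k≢i) eq)
    ... | neg = isFilter⇒isDirected⟨neg⟩ (proj₂ (adm k k≢i) eq)

    admissibleFᶦ⇒isDirected : ∀ {f i} {Fs : Fin (arᶠ f) → Pred Carrier ℓ} → AdmissibleFᶦ A f i Fs →
                              ∀ k → ¬ k ≡ i → IsDirected⟨ dual (εᶠ f k) ⟩ (Fs k)
    admissibleFᶦ⇒isDirected {f} adm k k≢i with εᶠ f k in eq
    ... | pos = isFilter⇒isDirected⟨neg⟩ (proj₁ (adm k k≢i) eq)
    ... | neg = isIdeal⇒isDirected⟨pos⟩ (proj₂ (adm k k≢i) eq)

mainTheorem12 : ∀ {L : LESig} {c ℓ₁ ℓ₂ ℓ : Level} (A : LEAlgebra L c ℓ₁ ℓ₂)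
    (F : Pred (LEAlgebra.Carrier A) ℓ) (I : Pred (LEAlgebra.Carrier A) ℓ) →
    IsFilter (LEAlgebra.boundedLattice A) F → IsIdeal (LEAlgebra.boundedLattice A) I →
    (∀ (g : LESig.GOp L) (i : Fin (LESig.arᵍ L g)) (Is : Fin (LESig.arᵍ L g) → Pred (LEAlgebra.Carrier A) ℓ) →
       AdmissibleGᶦ A g i Is →
       (LESig.εᵍ L g i ≡ pos → IsFilter (LEAlgebra.boundedLattice A) (gⁱ A g i F Is))
       × (LESig.εᵍ L g i ≡ neg → IsIdeal (LEAlgebra.boundedLattice A) (gⁱ A g i F Is)))
    × (∀ (f : LESig.FOp L) (i : Fin (LESig.arᶠ L f)) (Fs : Fin (LESig.arᶠ L f) → Pred (LEAlgebra.Carrier A) ℓ) →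
       AdmissibleFᶦ A f i Fs →
       (LESig.εᶠ L f i ≡ pos → IsIdeal (LEAlgebra.boundedLattice A) (fⁱ A f i I Fs))
       × (LESig.εᶠ L f i ≡ neg → IsFilter (LEAlgebra.boundedLattice A) (fⁱ A f i I Fs)))
mainTheorem12 {L} A F I F-filter I-ideal =
    (λ g i Is adm → isFilter⟨ εᵍ g i ⟩-cases
       (preimageAt-isFilter _ (gop-isDualOperator A g) F-filter i (admissibleGᶦ⇒isDirected A adm)))
  , (λ f i Fs adm → isFilter⟨dual εᶠ f i ⟩-cases
       (preimageAt-isFilter _ (fop-isDualOperator A f) (isIdeal⇒isFilter⟨neg⟩ I-ideal) i
                            (admissibleFᶦ⇒isDirected A adm)))
  where
  open LESig L
  open Polarised (LEAlgebra.boundedLattice A)
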